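{- Let $C$ be a super-Belnap calculus and let $R$ be the set of all its structural rules (Weakening, Contraction and its additional structural rules). Then $R$ satisfies the expansion property if and only if for every set of sequents $S$ and every sequent $\Gamma\vartriangleright\Delta$, if $\Gamma\vartriangleright\Delta$ has a proof from $S$ in $C$, then it has a structurally atomic proof from $S$ in $C$.
   Context: Formulas are built from atoms using $\wedge,\vee,{ - },\top,\bot$; a sequent $\Gamma\vartriangleright\Delta$ is a pair of finite multisets of formulas; atomic if all its formulas are atoms. The calculus $G\mathcal{B}$ consists of the logical rules and the structural rules Weakening and Contraction (on both sides). Logical rules = introduction rules (from $\Gamma\vartriangleright\Delta,\varphi$ and $\Gamma\vartriangleright\Delta,\psi$ infer $\Gamma\vartriangleright\Delta,\varphi\wedge\psi$; from $\varphi,\psi,\Gamma\vartriangleright\Delta$ infer $\varphi\wedge\psi,\Gamma\vartriangleright\Delta$; from $\varphi,\Gamma\vartriangleright\Delta$ and $\psi,\Gamma\vartriangleright\Delta$ infer $\varphi\vee\psi,\Gamma\vartriangleright\Delta$; from $\Gamma\vartriangleright\Delta,\varphi,\psi$ infer $\Gamma\vartriangleright\Delta,\varphi\vee\psi$; from $\varphi,\Gamma\vartriangleright\Delta$ infer $\Gamma\vartriangleright\Delta,{ - }\varphi$; from $\Gamma\vartriangleright\Delta,\varphi$ infer ${ - }\varphi,\Gamma\vartriangleright\Delta$; axioms $\emptyset\vartriangleright\top$, $\bot\vartriangleright\emptyset$) and elimination rules (the inverse of each of these two-way rules, e.g. from $\Gamma\vartriangleright\Delta,\varphi\wedge\psi$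 infer $\Gamma\vartriangleright\Delta,\varphi$ and also $\Gamma\vartriangleright\Delta,\psi$, from $\varphi\vee\psi,\Gamma\vartriangleright\Delta$ infer $\varphi,\Gamma\vartriangleright\Delta$ and also $\psi,\Gamma\vartriangleright\Delta$, from $\Gamma\vartriangleright\Delta,{ - }\varphi$ infer $\varphi,\Gamma\vartriangleright\Delta$, etc.; plus from $\top,\Gamma\vartriangleright\Delta$ infer $\Gamma\vartriangleright\Delta$ and from $\Gamma\vartriangleright\Delta,\bot$ infer $\Gamma\vartriangleright\Delta$). A structural rule is a rule (possibly infinitary) whose premises and conclusion are atomic sequents, applied in all substitution instances; a super-Belnap calculus is $G\mathcal{B}$ extended by a set of structural rules. A proof is structurally atomic if the premises and conclusions of all occurrences of structural rules in it are atomic sequents. A set $R$ of structural rules satisfies the expansion property if for each $\rho\in R$ and each substitution instance of $\rho$, the conclusion of the instance has a proof from the premises of the instance which uses only the logical rules and instances of rules in $R$ whose premises and conclusion are all atomic sequents. -}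

module Defs where

open import Data.Nat using (ℕ)
open import Data.Bool using (Bool; true; false)
open import Data.List using (List; []; _∷_; map)
open import Data.List.Relation.Unary.All using (All)
open import Data.List.Relation.Binary.Permutation.Propositional using (_↭_)
open import Data.Product using (Σ; ∃; _×_; _,_; proj₁; proj₂)
open import Data.Sum using (_⊎_; inj₁; inj₂)
open import Data.Unit using (⊤; tt)
open import Relation.Binary.PropositionalEquality using (_≡_)

Atom : Set
Atom = ℕ

data Fm : Set where
  atom : Atom → Fm
  _∧_  : Fm → Fm → Fm
  _∨_  : Fm → Fm → Fm
  -_   : Fm → Fm
  ⊤ᶠ   : Fm
  ⊥ᶠ   : Fm

-- Sequents Γ ▹ Δ: pairs of finite multisets, represented by lists
-- taken up to permutation (see the rule `exch` below).
infix 4 _▹_ _▷_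

record Sequent : Set where
  constructor _▹_
  field
    ante : List Fm
    succ : List Fm
open Sequent public

IsAtom : Fm → Set
IsAtom φ = ∃ λ p → φ ≡ atom p

AtomicSeq : Sequent → Set
AtomicSeq (Γ ▹ Δ) = All IsAtom Γ × All IsAtom Δ

-- Structural rules: (possibly infinitary) rules whose premises and
-- conclusion are atomic sequents (sequents of atoms), applied in all
-- substitution instances.

record ASequent : Set where
  constructor _▷_
  field
    aante : List Atom
    asucc : List Atom

record Rule : Set₁ where
  field
    Prem  : Set
    prem  : Prem → ASequent
    concl : ASequent
open Rule public

record RuleSet : Set₁ where
  field
    Idx  : Set
    rule : Idx → Rule
open RuleSet public

_∪ᴿ_ : RuleSet → RuleSet → RuleSet
R ∪ᴿ R' = record { Idx = Idx R ⊎ Idx R'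
                 ; rule = λ { (inj₁ i) → rule R i ; (inj₂ j) → rule R' j } }

Subst : Set
Subst = Atom → Fm

inst : Subst → ASequent → Sequent
inst σ (Γ ▷ Δ) = map σ Γ ▹ map σ Δ

AtomicInstance : Rule → Subst → Set
AtomicInstance ρ σ = ((i : Prem ρ) → AtomicSeq (inst σ (prem ρ i)))
                   × AtomicSeq (inst σ (concl ρ))

oneRule : ASequent → ASequent → Rule
oneRule s c = record { Prem = ⊤ ; prem = λ _ → s ; concl = c }

data WCIdx : Set where
  weakL weakR contrL contrR : List Atom → List Atom → Atom → WCIdx

WCrule : WCIdx → Rule
WCrule (weakL  Γ Δ p) = oneRule (Γ ▷ Δ) (p ∷ Γ ▷ Δ)
WCrule (weakR  Γ Δ p) = oneRule (Γ ▷ Δ) (Γ ▷ p ∷ Δ)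
WCrule (contrL Γ Δ p) = oneRule (p ∷ p ∷ Γ ▷ Δ) (p ∷ Γ ▷ Δ)
WCrule (contrR Γ Δ p) = oneRule (Γ ▷ p ∷ p ∷ Δ) (Γ ▷ p ∷ Δ)

WC : RuleSet
WC = record { Idx = WCIdx ; rule = WCrule }

-- The flag `at` = true restricts structural rule occurrences to
-- instances whose premises and conclusion are atomic sequents.

StrOK : Bool → Rule → Subst → Set
StrOK true  ρ σ = AtomicInstance ρ σ
StrOK false ρ σ = ⊤

data Der (R : RuleSet) (at : Bool) (S : Sequent → Set) : Sequent → Set₁ where
  hyp  : ∀ {s} → S s → Der R at S s
  exch : ∀ {Γ Δ Γ' Δ'} → Γ ↭ Γ' → Δ ↭ Δ' → Der R at S (Γ ▹ Δ) → Der R at S (Γ' ▹ Δ')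
  str  : (j : Idx R) (σ : Subst) → StrOK at (rule R j) σ →
         ((i : Prem (rule R j)) → Der R at S (inst σ (prem (rule R j) i))) →
         Der R at S (inst σ (concl (rule R j)))
  ∧R   : ∀ {Γ Δ φ ψ} → Der R at S (Γ ▹ φ ∷ Δ) → Der R at S (Γ ▹ ψ ∷ Δ) → Der R at S (Γ ▹ (φ ∧ ψ) ∷ Δ)
  ∧L   : ∀ {Γ Δ φ ψ} → Der R at S (φ ∷ ψ ∷ Γ ▹ Δ) → Der R at S ((φ ∧ ψ) ∷ Γ ▹ Δ)
  ∨L   : ∀ {Γ Δ φ ψ} → Der R at S (φ ∷ Γ ▹ Δ) → Der R at S (ψ ∷ Γ ▹ Δ) → Der R at S ((φ ∨ ψ) ∷ Γ ▹ Δ)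
  ∨R   : ∀ {Γ Δ φ ψ} → Der R at S (Γ ▹ φ ∷ ψ ∷ Δ) → Der R at S (Γ ▹ (φ ∨ ψ) ∷ Δ)
  -R   : ∀ {Γ Δ φ} → Der R at S (φ ∷ Γ ▹ Δ) → Der R at S (Γ ▹ (- φ) ∷ Δ)
  -L   : ∀ {Γ Δ φ} → Der R at S (Γ ▹ φ ∷ Δ) → Der R at S ((- φ) ∷ Γ ▹ Δ)
  ⊤R   : Der R at S ([] ▹ ⊤ᶠ ∷ [])
  ⊥L   : Der R at S (⊥ᶠ ∷ [] ▹ [])
  ∧R-e₁ : ∀ {Γ Δ φ ψ} → Der R at S (Γ ▹ (φ ∧ ψ) ∷ Δ) → Der R at S (Γ ▹ φ ∷ Δ)
  ∧R-e₂ : ∀ {Γ Δ φ ψ} → Der R at S (Γ ▹ (φ ∧ ψ) ∷ Δ) → Der R at S (Γ ▹ ψ ∷ Δ)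
  ∧L-e  : ∀ {Γ Δ φ ψ} → Der R at S ((φ ∧ ψ) ∷ Γ ▹ Δ) → Der R at S (φ ∷ ψ ∷ Γ ▹ Δ)
  ∨L-e₁ : ∀ {Γ Δ φ ψ} → Der R at S ((φ ∨ ψ) ∷ Γ ▹ Δ) → Der R at S (φ ∷ Γ ▹ Δ)
  ∨L-e₂ : ∀ {Γ Δ φ ψ} → Der R at S ((φ ∨ ψ) ∷ Γ ▹ Δ) → Der R at S (ψ ∷ Γ ▹ Δ)
  ∨R-e  : ∀ {Γ Δ φ ψ} → Der R at S (Γ ▹ (φ ∨ ψ) ∷ Δ) → Der R at S (Γ ▹ φ ∷ ψ ∷ Δ)
  -R-e  : ∀ {Γ Δ φ} → Der R at S (Γ ▹ (- φ) ∷ Δ) → Der R at S (φ ∷ Γ ▹ Δ)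
  -L-e  : ∀ {Γ Δ φ} → Der R at S ((- φ) ∷ Γ ▹ Δ) → Der R at S (Γ ▹ φ ∷ Δ)
  ⊤L-e  : ∀ {Γ Δ} → Der R at S (⊤ᶠ ∷ Γ ▹ Δ) → Der R at S (Γ ▹ Δ)
  ⊥R-e  : ∀ {Γ Δ} → Der R at S (Γ ▹ ⊥ᶠ ∷ Δ) → Der R at S (Γ ▹ Δ)

-- proofs in the super-Belnap calculus C = G𝓑 + X, whose structural
-- rules are R = Weakening + Contraction + X
AllStr : RuleSet → RuleSet
AllStr X = WC ∪ᴿ X

Proof : RuleSet → (Sequent → Set) → Sequent → Set₁
Proof R S s = Der R false S s

StructurallyAtomicProof : RuleSet → (Sequent → Set) → Sequent → Set₁
StructurallyAtomicProof R S s = Der R true S s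

PremisesOf : Rule → Subst → Sequent → Set
PremisesOf ρ σ s = Σ (Prem ρ) λ i → s ≡ inst σ (prem ρ i)

ExpansionProperty : RuleSet → Set₁
ExpansionProperty R = (j : Idx R) (σ : Subst) →
  Der R true (PremisesOf (rule R j) σ) (inst σ (concl (rule R j)))

module Submission where

open import Defs
open import Data.Bool using (Bool; true; false)
open import Data.Product using (_×_; _,_)
open import Data.Unit using (tt)
open import Relation.Binary.PropositionalEquality using (refl)

-- Under the expansion property every structural step is replaced
-- by an atomic-instance proof of its conclusion from its premises, with the
-- (recursively atomised) proofs of those premises grafted on; conversely, a
-- single structural step proves its conclusion from its premises, and
-- atomising that one-step proof is exactly the expansion property.

module _ {R : RuleSet} {a b : Bool} {S T : Sequent → Set} where

  Der-fold : (∀ {t} → S t → Der R b T t) →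
             (∀ j σ → StrOK a (rule R j) σ →
                ((i : Prem (rule R j)) → Der R b T (inst σ (prem (rule R j) i))) →
                Der R b T (inst σ (concl (rule R j)))) →
             ∀ {s} → Der R a S s → Der R b T s
  Der-fold h f = go
    where
    go : ∀ {s} → Der R a S s → Der R b T s
    go (hyp x)         = h x
    go (exch p q d)    = exch p q (go d)
    go (str j σ ok ds) = f j σ ok (λ i → go (ds i))
    go (∧R d e)        = ∧R (go d) (go e)
    go (∧L d)          = ∧L (go d)
    go (∨L d e)        = ∨L (go d) (go e)
    go (∨R d)          = ∨R (go d)
    go (-R d)          = -R (go d)
    go (-L d)          = -L (go d)
    go ⊤R              = ⊤R
    go ⊥L              = ⊥L
    go (∧R-e₁ d)       = ∧R-e₁ (go d)
    go (∧R-e₂ d)       = ∧R-e₂ (go d)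
    go (∧L-e d)        = ∧L-e (go d)
    go (∨L-e₁ d)       = ∨L-e₁ (go d)
    go (∨L-e₂ d)       = ∨L-e₂ (go d)
    go (∨R-e d)        = ∨R-e (go d)
    go (-R-e d)        = -R-e (go d)
    go (-L-e d)        = -L-e (go d)
    go (⊤L-e d)        = ⊤L-e (go d)
    go (⊥R-e d)        = ⊥R-e (go d)

Der-bind : ∀ {R at} {S T : Sequent → Set} {s} →
           Der R at S s → (∀ {t} → S t → Der R at T t) → Der R at T s
Der-bind d h = Der-fold h (λ j σ ok ds → str j σ ok ds) d

structurallyAtomic : ∀ {R} {S : Sequent → Set} {s} →
                     ExpansionProperty R → Der R false S s → Der R true S s
structurallyAtomic E = Der-fold hyp λ j σ _ ds →
  Der-bind (E j σ) λ { (i , refl) → ds i }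

rule-instance : ∀ {R} (j : Idx R) (σ : Subst) →
                Der R false (PremisesOf (rule R j) σ) (inst σ (concl (rule R j)))
rule-instance j σ = str j σ tt (λ i → hyp (i , refl))

proposition4p7 : (X : RuleSet) →
    (ExpansionProperty (AllStr X) →
       ∀ (S : Sequent → Set) (s : Sequent) → Proof (AllStr X) S s → StructurallyAtomicProof (AllStr X) S s)
    × ((∀ (S : Sequent → Set) (s : Sequent) → Proof (AllStr X) S s → StructurallyAtomicProof (AllStr X) S s) →
       ExpansionProperty (AllStr X))
proposition4p7 X = (λ E S s → structurallyAtomic E)
                 , (λ atomise j σ → atomise _ _ (rule-instance j σ))
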